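{- Let $T$ be a finite tree and $g$ a positive integer. If the procedure Burn-Guess-Tree$(T,g)$ returns a burning sequence, then burning $T$ according to that sequence completes within at most $2g$ rounds.
   Context: Graph burning: rounds $1,2,\dots$; initially nothing burns; in each round every neighbour of a burning vertex becomes burning and a new fire is started at the activator of that round (if the designated activator is already burning, nothing further happens). A vertex stays burning forever; the graph is burned when all vertices are burning. Procedure Burn-Guess-Tree$(T,g)$: choose an arbitrary root $s$ of $T$; the level of a vertex is its distance to $s$, and the $g$-ancestor of $v$ is the vertex at distance $g$ from $v$ on the path from $v$ to $s$. Maintain a set of centers (initially empty) and a set of marked vertices (initially empty). Repeatedly: take an unmarked vertex $v$ of highest level; if its level is at least $g$, add the $g$-ancestor of $v$ to the centers, otherwise add $s$ to the centers; then mark all vertices within distance $g$ of the added center. If all vertices become marked, return the burning sequence consisting of the centers in arbitrary order (the $i$-th center is the activator of round $i$). If $g$ centers have been chosen and some vertex is still unmarked (so more than $g$ centers would be needed), return Bad-Guess. -}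

module Defs where

open import Data.Nat using (ℕ; zero; suc; _≤_; _<_; _∸_; _*_)
open import Data.Fin using (Fin)
open import Data.List using (List; []; _∷_; _++_; [_]; length)
open import Data.List.Relation.Unary.Any using (Any)
open import Data.List.Relation.Unary.Unique.Propositional using (Unique)
open import Data.Product using (Σ; _×_; ∃)
open import Data.Sum using (_⊎_)
open import Data.Empty using (⊥)
open import Data.Unit using (⊤)
open import Relation.Nullary using (¬_)
open import Relation.Binary.PropositionalEquality using (_≡_)

module _ {n : ℕ} (Adj : Fin n → Fin n → Set) where

  record IsSimpleGraph : Set where
    field
      sym   : ∀ u v → Adj u v → Adj v u
      irrfl : ∀ v → ¬ Adj v v

  -- Within d u v : there is a walk of length ≤ d from u to v  (dist(u,v) ≤ d)
  data Within : ℕ → Fin n → Fin n → Set where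
    here  : ∀ {d u} → Within d u u
    there : ∀ {d u w v} → Adj u w → Within d w v → Within (suc d) u v

  Dist : Fin n → Fin n → ℕ → Set
  Dist u v ℓ = Within ℓ u v × (∀ m → Within m u v → ℓ ≤ m)

  Chain : List (Fin n) → Set
  Chain []           = ⊤
  Chain (x ∷ [])     = ⊤
  Chain (x ∷ y ∷ zs) = Adj x y × Chain (y ∷ zs)

  HasCycle : Set
  HasCycle = Σ (Fin n) λ x → Σ (List (Fin n)) λ ys →
    (2 ≤ length ys) × Unique (x ∷ ys) × Chain (x ∷ ys ++ [ x ])

  Connected : Set
  Connected = ∀ u v → ∃ λ d → Within d u v

  record IsTree : Set where
    field
      simple    : IsSimpleGraph
      connected : Connected
      acyclic   : ¬ HasCycle

  -- Procedure Burn-Guess-Tree(T, g) with root s (nondeterministic: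
  -- root, tie-breaking among highest unmarked vertices are arbitrary)

  module _ (g : ℕ) (s : Fin n) where

    Marked : List (Fin n) → Fin n → Set
    Marked cs v = Any (λ c → Within g c v) cs

    -- a is the g-ancestor of v, where v has level ℓ (g ≤ ℓ):
    -- the vertex at distance g from v on the v–s path
    GAncestor : Fin n → ℕ → Fin n → Set
    GAncestor v ℓ a = Dist v a g × Dist s a (ℓ ∸ g)

    CenterFor : Fin n → ℕ → Fin n → Set
    CenterFor v ℓ c = (g ≤ ℓ × GAncestor v ℓ c) ⊎ (ℓ < g × c ≡ s)

    -- Run cs : the procedure can reach the state with centers cs (in order of choice)
    -- without having returned. A step is only taken while fewer than g centers
    -- have been chosen (otherwise Bad-Guess is returned).
    data Run : List (Fin n) → Set where
      start : Run []
      step  : ∀ {cs} v ℓ c →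
              Run cs →
              length cs < g →
              ¬ Marked cs v →
              Dist s v ℓ →
              (∀ u ℓu → ¬ Marked cs u → Dist s u ℓu → ℓu ≤ ℓ) →
              CenterFor v ℓ c →
              Run (cs ++ [ c ])

    Returns : List (Fin n) → Set
    Returns cs = Run cs × (∀ v → Marked cs v)

  At : List (Fin n) → ℕ → Fin n → Set
  At []       i       x = ⊥
  At (y ∷ ys) zero    x = y ≡ x
  At (y ∷ ys) (suc i) x = At ys i x

  -- Burning seq r v : v is burning after round r, where the activator of
  -- round r+1 is the entry of seq at index r (if any)
  data Burning (seq : List (Fin n)) : ℕ → Fin n → Set where
    stays  : ∀ {r v} → Burning seq r v → Burning seq (suc r) v
    spread : ∀ {r u v} → Burning seq r u → Adj u v → Burning seq (suc r) v
    ignite : ∀ {r v} → At seq r v → Burning seq (suc r) v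

-- A vertex v is marked, so it lies within distance g of some center c, and c
-- occurs in the burning sequence at a position i < g because the procedure
-- never chooses more than g centers. The fire started at c in round i + 1
-- reaches v at most g rounds later, i.e. by round g + i + 1 ≤ 2g.
module Submission where

open import Defs
open import Data.Nat using (ℕ; _≤_; _≤′_; ≤′-refl; ≤′-step; _*_; _+_; z≤n)
open import Data.Nat.Properties using (≤⇒≤′; m≤n+m; +-suc; +-comm; +-identityʳ; +-monoʳ-≤)
open import Data.Fin using (Fin; toℕ)
open import Data.Fin.Properties using (toℕ<n)
open import Data.List using (List; length)
open import Data.List.Properties using (length-++)
open import Data.List.Relation.Unary.Any using (Any; here; there; index; lookup)
open import Data.List.Relation.Unary.Any.Properties using (lookup-result)
open import Data.List.Relation.Binary.Permutation.Propositional using (_↭_; ↭-sym)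
open import Data.List.Relation.Binary.Permutation.Propositional.Properties
  using (Any-resp-↭; ↭-length)
open import Data.Product using (_,_)
open import Relation.Binary.PropositionalEquality using (refl; sym; trans; cong; subst)

module _ {n : ℕ} {Adj : Fin n → Fin n → Set} where

  Burning-mono : ∀ {seq r r′ v} → r ≤ r′ → Burning Adj seq r v → Burning Adj seq r′ v
  Burning-mono {seq} {r} {v = v} r≤r′ b = go (≤⇒≤′ r≤r′)
    where
    go : ∀ {r′} → r ≤′ r′ → Burning Adj seq r′ v
    go ≤′-refl        = b
    go (≤′-step r≤′r′) = stays (go r≤′r′)

  Burning-within : ∀ {seq r d u v} →
    Burning Adj seq r u → Within Adj d u v → Burning Adj seq (d + r) v
  Burning-within {r = r} {d} b here = Burning-mono (m≤n+m r d) b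
  Burning-within {seq} {r} {v = v} b (there {d = d} u~w w⇝v) =
    subst (λ k → Burning Adj seq k v) (+-suc d r) (Burning-within (spread b u~w) w⇝v)

  At-lookup : ∀ {P : Fin n → Set} {xs} (p : Any P xs) → At Adj xs (toℕ (index p)) (lookup p)
  At-lookup (here _)  = refl
  At-lookup (there p) = At-lookup p

  Run-length≤ : ∀ {g s cs} → Run Adj g s cs → length cs ≤ g
  Run-length≤ start = z≤n
  Run-length≤ (step {cs} _ _ _ _ |cs|<g _ _ _ _) =
    subst (_≤ _) (sym (trans (length-++ cs) (+-comm (length cs) 1))) |cs|<g

  Burning-withinSomeActivator : ∀ {seq d v} → Any (λ c → Within Adj d c v) seq →
    Burning Adj seq (d + length seq) v
  Burning-withinSomeActivator {d = d} c⇝v =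
    Burning-mono (+-monoʳ-≤ d (toℕ<n (index c⇝v)))
      (Burning-within (ignite (At-lookup c⇝v)) (lookup-result c⇝v))

lemma4 : ∀ {n} (Adj : Fin n → Fin n → Set) → IsTree Adj →
    (g : ℕ) → 1 ≤ g → (s : Fin n) → (cs : List (Fin n)) →
    Returns Adj g s cs →
    (seq : List (Fin n)) → seq ↭ cs →
    ∀ v → Burning Adj seq (2 * g) v
lemma4 Adj _ g _ s cs (run , allMarked) seq seq↭cs v =
  Burning-mono g+|seq|≤2g (Burning-withinSomeActivator (Any-resp-↭ (↭-sym seq↭cs) (allMarked v)))
  where
  g+|seq|≤2g : g + length seq ≤ 2 * g
  g+|seq|≤2g = subst (g + length seq ≤_) (cong (g +_) (sym (+-identityʳ g)))
    (+-monoʳ-≤ g (subst (_≤ g) (sym (↭-length seq↭cs)) (Run-length≤ run)))
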